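{- Let $\Delta \geq 3$ and $n \geq 3$ be integers, let $T_n$ be the complete $\Delta$-ary tree on the vertex set $\{1,\dots,n\}$, and run the construction algorithm described in the context on $T_n$, with arbitrary choices at every step where a choice is allowed. Then the algorithm is well defined: whenever an unmarked leaf is requested, one exists. Moreover, the recorded vertices $c_1, c_2, \dots, c_n$ are pairwise distinct and form a hamiltonian cycle $c_1 c_2 \cdots c_n c_1$ of the output graph $G$. In particular, $G$ is hamiltonian.
   Context: Let $b = \Delta - 1$. The complete $\Delta$-ary tree $T_n$ is the rooted tree on vertex set $\{1,\dots,n\}$ with root $1$ in which the parent of each vertex $i \geq 2$ is $\lceil (i-1)/b \rceil$. Equivalently, every vertex has at most $\Delta-1$ children, every vertex not on the last level has exactly $\Delta-1$ children, and the last level is filled from the left. A leaf is a vertex with no children. The construction algorithm proceeds as follows. Initially no vertex is marked, the current vertex is $v := 1$, and the edge set of the graph $G$ is the edge set of $T_n$. For $k = 1, 2, \dots, n$, do the following: - Set $c_k := v$ and mark $v$. - If $k < n$, update the current vertex: - if $v \neq 1$ and the parent of $v$ is unmarked, set $v :=$ the parent of $v$; - otherwise, if $v$ has an unmarked child, set $v :=$ any such child $u$; - otherwise, choose any unmarked leaf $u$, add the edge $\{v,u\}$ to $G$, and set $v := u$. After the loop, add the edge $\{c_n, 1\}$ to $G$. Graphs are simple: adding an edge that is already present does not change $G$. A hamiltonian cycle is a cycle through all vertices exactly once, where a cycle has at least three vertices. -}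

module Defs where

open import Data.Nat using (ℕ; zero; suc; _+_; _∸_; _≤_; _<_)
open import Data.Nat.DivMod using (_/_)
open import Data.Product using (_×_; _,_; ∃)
open import Data.Sum using (_⊎_)
open import Data.Empty using (⊥)
open import Data.Unit using (⊤)
open import Data.List using (List; []; _∷_; length)
open import Data.List.Membership.Propositional using (_∈_; _∉_)
open import Data.List.Relation.Unary.Unique.Propositional using (Unique)
open import Relation.Nullary using (¬_)
open import Relation.Binary.PropositionalEquality using (_≡_; _≢_)
open import Function.Bundles using (_⇔_)

-- Branching factor b = Δ - 1, written as suc (Δ ∸ 2) (equal to Δ - 1 for Δ ≥ 2).
-- parent Δ i = ⌈ (i - 1) / b ⌉ = ((i - 1) + (b - 1)) / b.
parent : ℕ → ℕ → ℕ
parent Δ i = ((i ∸ 1) + (Δ ∸ 2)) / suc (Δ ∸ 2)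

IsVertex : ℕ → ℕ → Set
IsVertex n v = 1 ≤ v × v ≤ n

IsChild : ℕ → ℕ → ℕ → ℕ → Set
IsChild Δ n v u = 2 ≤ u × u ≤ n × parent Δ u ≡ v

IsLeaf : ℕ → ℕ → ℕ → Set
IsLeaf Δ n u = IsVertex n u × (∀ w → ¬ IsChild Δ n u w)

ParentCase : ℕ → ℕ → List ℕ → Set
ParentCase Δ v marked = v ≢ 1 × parent Δ v ∉ marked

-- Run Δ n cs E : the algorithm has recorded c_1, ..., c_k where
-- cs = c_k ∷ ... ∷ c_1 (reversed; the marked set is exactly cs, and the current
-- vertex is c_k), and E (a list of pairs (v , u)) is the list of edges {v,u}
-- added so far (besides the tree edges).
-- Each constructor performs one update of the current vertex (at a step k < n)
-- followed by the recording/marking of the new current vertex.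
data Run (Δ n : ℕ) : List ℕ → List (ℕ × ℕ) → Set where
  start : Run Δ n (1 ∷ []) []
  up    : ∀ {v cs E} → Run Δ n (v ∷ cs) E → length (v ∷ cs) < n →
          ParentCase Δ v (v ∷ cs) →
          Run Δ n (parent Δ v ∷ v ∷ cs) E
  down  : ∀ {v cs E u} → Run Δ n (v ∷ cs) E → length (v ∷ cs) < n →
          ¬ ParentCase Δ v (v ∷ cs) →
          IsChild Δ n v u → u ∉ (v ∷ cs) →
          Run Δ n (u ∷ v ∷ cs) E
  jump  : ∀ {v cs E u} → Run Δ n (v ∷ cs) E → length (v ∷ cs) < n →
          ¬ ParentCase Δ v (v ∷ cs) →
          (∀ w → IsChild Δ n v w → w ∈ (v ∷ cs)) →
          IsLeaf Δ n u → u ∉ (v ∷ cs) →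
          Run Δ n (u ∷ v ∷ cs) ((v , u) ∷ E)

-- Directed "edge generators" of the output graph G:
-- tree edges {i, parent i} (2 ≤ i ≤ n), added edges E, and the final edge {c_n, 1}.
EdgeGen : ℕ → ℕ → List (ℕ × ℕ) → ℕ → ℕ → ℕ → Set
EdgeGen Δ n E cn x y =
  (2 ≤ x × x ≤ n × y ≡ parent Δ x) ⊎ ((x , y) ∈ E) ⊎ (x ≡ cn × y ≡ 1)

AdjG : ℕ → ℕ → List (ℕ × ℕ) → ℕ → ℕ → ℕ → Set
AdjG Δ n E cn x y =
  IsVertex n x × IsVertex n y × x ≢ y × (EdgeGen Δ n E cn x y ⊎ EdgeGen Δ n E cn y x)

Path : (ℕ → ℕ → Set) → List ℕ → Set
Path Adj [] = ⊤
Path Adj (x ∷ []) = ⊤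
Path Adj (x ∷ y ∷ rest) = Adj x y × Path Adj (y ∷ rest)

lastOf : ℕ → List ℕ → ℕ
lastOf c [] = c
lastOf c (d ∷ ds) = lastOf d ds

IsHamCycle : ℕ → (ℕ → ℕ → Set) → List ℕ → Set
IsHamCycle n Adj [] = ⊥
IsHamCycle n Adj (c ∷ cs) =
  3 ≤ length (c ∷ cs) × Unique (c ∷ cs) ×
  (∀ x → x ∈ (c ∷ cs) ⇔ IsVertex n x) ×
  Path Adj (c ∷ cs) × Adj (lastOf c cs) c

IsHamiltonian : ℕ → (ℕ → ℕ → Set) → Set
IsHamiltonian n Adj = ∃ λ cyc → IsHamCycle n Adj cyc

-- The run maintains an invariant: the recorded vertices are distinct, c₁ = 1, consecutive
-- recorded vertices are joined by a tree edge or an added edge, and every marked vertex other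
-- than the root and the current vertex has a marked parent.  When the parent branch is not
-- taken, the current vertex has a marked parent too, so the marked set is closed under parents.
-- Then the largest unmarked vertex is a leaf: its children are larger, hence marked, and a
-- marked child would force it to be marked.  Once n vertices are recorded they are all the
-- vertices, and the final edge {cₙ, 1} closes the walk c₁ ⋯ cₙ into a hamiltonian cycle.
module Submission where

open import Defs
open import Data.Nat using (ℕ; zero; suc; _+_; _*_; _∸_; _≤_; _<_; z≤n; s≤s; _≟_)
open import Data.Nat.Properties
open import Data.Nat.DivMod using (m<n*o⇒m/o<n; m≥n⇒m/n>0)
open import Data.Product using (_×_; _,_; ∃; proj₁; proj₂)
open import Data.Sum using (_⊎_; inj₁; inj₂)
import Data.Sum as Sum
open import Data.Unit using (tt)
open import Data.List using (List; []; _∷_; length; reverse; reverseAcc; applyUpTo)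
open import Data.List.Properties using (length-reverse; length-applyUpTo; length-removeAt′)
open import Data.List.Membership.Propositional using (_∈_; _∉_)
open import Data.List.Membership.Propositional.Properties using (∈-applyUpTo⁺; ∈-applyUpTo⁻)
open import Data.List.Membership.DecPropositional _≟_ using (_∈?_)
open import Data.List.Relation.Unary.Any using (here; there; _─_; index)
open import Data.List.Relation.Unary.All using (All; []; _∷_; lookup)
import Data.List.Relation.Unary.All as All
open import Data.List.Relation.Unary.All.Properties using (¬Any⇒All¬)
open import Data.List.Relation.Unary.AllPairs using ([]; _∷_)
open import Data.List.Relation.Unary.Unique.Propositional using (Unique)
open import Data.List.Relation.Unary.Unique.Propositional.Properties
  using (applyUpTo⁺₁; Unique[x∷xs]⇒x∉xs)
open import Data.List.Relation.Binary.Permutation.Propositional using (↭-sym; ↭⇒↭ₛ)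
open import Data.List.Relation.Binary.Permutation.Propositional.Properties
  using (↭-reverse; ∈-resp-↭)
import Data.List.Relation.Binary.Permutation.Setoid.Properties as PermutationSetoid
open import Relation.Nullary using (¬_; yes; no; contradiction)
open import Relation.Nullary.Decidable using (decidable-stable)
open import Relation.Unary using (Pred; Decidable)
open import Relation.Binary using (Rel; Symmetric; _⇒_)
open import Relation.Binary.Construct.Closure.Symmetric using (SymClosure; fwd; bwd)
import Relation.Binary.Construct.Closure.Symmetric as SymClosure
open import Relation.Binary.PropositionalEquality
  using (_≡_; _≢_; refl; sym; trans; cong; subst; ≢-sym; setoid)
open import Function.Base using (_∘_)
open import Function.Bundles using (_⇔_; mk⇔; Equivalence)
open Equivalence using (to; from)
open import Level using (0ℓ)

parent<self : ∀ Δ {v} → 2 ≤ v → parent Δ v < v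
parent<self Δ {suc zero} (s≤s ())
parent<self Δ {suc (suc k)} _ = m<n*o⇒m/o<n {suc k + b} {suc (suc k)} {suc b} bound
  where
  b = Δ ∸ 2
  open ≤-Reasoning
  bound : suc (suc k + b) ≤ suc (suc k) * suc b
  bound = begin
    suc (suc k + b)     ≡⟨ cong suc (+-comm (suc k) b) ⟩
    suc b + suc k       ≤⟨ +-monoʳ-≤ (suc b) (m≤m*n (suc k) (suc b)) ⟩
    suc b + suc k * suc b ∎

parent≥1 : ∀ Δ {v} → 2 ≤ v → 1 ≤ parent Δ v
parent≥1 Δ {suc zero} (s≤s ())
parent≥1 Δ {suc (suc k)} _ =
  m≥n⇒m/n>0 {suc k + (Δ ∸ 2)} {suc (Δ ∸ 2)} (s≤s (m≤n+m (Δ ∸ 2) k))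

parent-isVertex : ∀ Δ {n v} → 2 ≤ v → v ≤ n → IsVertex n (parent Δ v)
parent-isVertex Δ v≥2 v≤n = parent≥1 Δ v≥2 , ≤-trans (<⇒≤ (parent<self Δ v≥2)) v≤n

Path-map : {R S : Rel ℕ 0ℓ} → R ⇒ S → ∀ {xs} → Path R xs → Path S xs
Path-map R⇒S {[]} _ = tt
Path-map R⇒S {_ ∷ []} _ = tt
Path-map R⇒S {_ ∷ _ ∷ _} (r , p) = R⇒S r , Path-map R⇒S p

Path-restrict : {P : Pred ℕ 0ℓ} {R : Rel ℕ 0ℓ} → ∀ {xs} → All P xs → Unique xs → Path R xs →
  Path (λ x y → P x × P y × x ≢ y × R x y) xs
Path-restrict {xs = []} _ _ _ = tt
Path-restrict {xs = _ ∷ []} _ _ _ = tt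
Path-restrict {xs = _ ∷ _ ∷ _} (px ∷ py ∷ ps) ((x≢y ∷ _) ∷ u) (r , p) =
  (px , py , x≢y , r) , Path-restrict (py ∷ ps) u p

Path-reverse : {R : Rel ℕ 0ℓ} → Symmetric R → ∀ {xs} → Path R xs → Path R (reverse xs)
Path-reverse R-sym {[]} _ = tt
Path-reverse {R} R-sym {x ∷ xs} p = go p tt
  where
  go : ∀ {x xs acc} → Path R (x ∷ xs) → Path R (x ∷ acc) → Path R (reverseAcc (x ∷ acc) xs)
  go {xs = []} _ q = q
  go {xs = _ ∷ _} (r , p) q = go p (R-sym r , q)

lastOf-∈ : ∀ (d : ℕ) ds → lastOf d ds ∈ d ∷ ds
lastOf-∈ d [] = here refl
lastOf-∈ d (e ∷ ds) = there (lastOf-∈ e ds)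

reverse-∷ : ∀ (c : ℕ) cs →
  ∃ λ ds → reverse (c ∷ cs) ≡ lastOf c cs ∷ ds × lastOf (lastOf c cs) ds ≡ c
reverse-∷ c cs = go c [] cs
  where
  go : ∀ a acc cs → ∃ λ ds →
    reverseAcc (a ∷ acc) cs ≡ lastOf a cs ∷ ds × lastOf (lastOf a cs) ds ≡ lastOf a acc
  go a acc [] = acc , refl , refl
  go a acc (c ∷ cs) = go c (a ∷ acc) cs

Unique-reverse : ∀ {A : Set} {xs : List A} → Unique xs → Unique (reverse xs)
Unique-reverse {A} {xs} =
  PermutationSetoid.Unique-resp-↭ (setoid A) (↭⇒↭ₛ (↭-sym (↭-reverse xs)))

IsHamCycle-reverse : ∀ {n} {Adj : Rel ℕ 0ℓ} → Symmetric Adj → ∀ {c cs} →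
  IsHamCycle n Adj (c ∷ cs) → IsHamCycle n Adj (reverse (c ∷ cs))
IsHamCycle-reverse {Adj = Adj} Adj-sym {c} {cs} (len , unique , cover , path , close)
  -- Abstracting reverse (c ∷ cs) in all these facts lets the view reverse-∷ expose its head.
  with reverse (c ∷ cs) | length-reverse (c ∷ cs) | Unique-reverse unique
     | (λ {x} → ∈-resp-↭ {x = x} (↭-sym (↭-reverse (c ∷ cs))))
     | (λ {x} → ∈-resp-↭ {x = x} (↭-reverse (c ∷ cs)))
     | Path-reverse Adj-sym path | reverse-∷ c cs
... | .(lastOf c cs ∷ ds) | length-rev | unique-rev | ∈-rev⁺ | ∈-rev⁻ | path-rev
    | ds , refl , last≡c =
  subst (3 ≤_) (sym length-rev) len , unique-rev ,
  (λ x → mk⇔ (to (cover x) ∘ ∈-rev⁻) (∈-rev⁺ ∘ from (cover x))) ,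
  path-rev , subst (λ z → Adj z (lastOf c cs)) (sym last≡c) (Adj-sym close)

∈-─⁺ : ∀ {A : Set} {x z : A} {ys} (x∈ys : x ∈ ys) → z ∈ ys → z ≢ x → z ∈ (ys ─ x∈ys)
∈-─⁺ (here refl) (here refl) z≢x = contradiction refl z≢x
∈-─⁺ (here refl) (there z∈ys) _ = z∈ys
∈-─⁺ (there _) (here refl) _ = here refl
∈-─⁺ (there x∈ys) (there z∈ys) z≢x = there (∈-─⁺ x∈ys z∈ys z≢x)

Unique-⊆⇒length≤ : ∀ {A : Set} {xs ys : List A} →
  Unique xs → All (_∈ ys) xs → length xs ≤ length ys
Unique-⊆⇒length≤ [] [] = z≤n
Unique-⊆⇒length≤ {xs = x ∷ xs} {ys} (x∉xs ∷ u) (x∈ys ∷ xs⊆ys) =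
  subst (suc (length xs) ≤_) (sym (length-removeAt′ ys (index x∈ys)))
    (s≤s (Unique-⊆⇒length≤ u (All-─ x∉xs xs⊆ys)))
  where
  All-─ : ∀ {zs} → All (x ≢_) zs → All (_∈ ys) zs → All (_∈ (ys ─ x∈ys)) zs
  All-─ [] [] = []
  All-─ (x≢z ∷ ps) (z∈ys ∷ qs) = ∈-─⁺ x∈ys z∈ys (≢-sym x≢z) ∷ All-─ ps qs

Unique-⊆-length≥⇒⊇ : ∀ {xs ys : List ℕ} → Unique xs → All (_∈ ys) xs → length ys ≤ length xs →
  ∀ {y} → y ∈ ys → y ∈ xs
Unique-⊆-length≥⇒⊇ {xs} u xs⊆ys ys≤xs {y} y∈ys with y ∈? xs
... | yes y∈xs = y∈xs
... | no y∉xs =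
  contradiction (≤-trans (Unique-⊆⇒length≤ (¬Any⇒All¬ xs y∉xs ∷ u) (y∈ys ∷ xs⊆ys)) ys≤xs) 1+n≰n

vertices : ℕ → List ℕ
vertices n = applyUpTo suc n

IsVertex⇒∈vertices : ∀ {n x} → IsVertex n x → x ∈ vertices n
IsVertex⇒∈vertices {x = suc x} (_ , x<n) = ∈-applyUpTo⁺ suc x<n

∈vertices⇒IsVertex : ∀ {n x} → x ∈ vertices n → IsVertex n x
∈vertices⇒IsVertex x∈ with ∈-applyUpTo⁻ suc x∈
... | i , i<n , refl = s≤s z≤n , i<n

Unique-vertices : ∀ n → Unique (vertices n)
Unique-vertices n = applyUpTo⁺₁ suc n (λ i<j _ → <⇒≢ (s≤s i<j))

greatestCounterexample : {P : Pred ℕ 0ℓ} → Decidable P → ∀ k → ¬ (∀ z → IsVertex k z → P z) →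
  ∃ λ w → IsVertex k w × ¬ P w × (∀ z → w < z → z ≤ k → P z)
greatestCounterexample P? zero ¬all =
  contradiction (λ z (1≤z , z≤0) → contradiction (≤-trans 1≤z z≤0) λ ()) ¬all
greatestCounterexample {P} P? (suc k) ¬all with P? (suc k)
... | no ¬P = suc k , (s≤s z≤n , ≤-refl) , ¬P , λ z k<z z≤k → contradiction z≤k (<⇒≱ k<z)
... | yes P[1+k] with greatestCounterexample P? k (λ all≤k → ¬all (extend all≤k))
  where
  extend : (∀ z → IsVertex k z → P z) → ∀ z → IsVertex (suc k) z → P z
  extend all≤k z (1≤z , z≤1+k) with z ≟ suc k
  ... | yes refl = P[1+k]
  ... | no z≢1+k = all≤k z (1≤z , m<1+n⇒m≤n (≤∧≢⇒< z≤1+k z≢1+k))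
... | w , (1≤w , w≤k) , ¬Pw , above =
  w , (1≤w , m≤n⇒m≤1+n w≤k) , ¬Pw , above′
  where
  above′ : ∀ z → w < z → z ≤ suc k → P z
  above′ z w<z z≤1+k with z ≟ suc k
  ... | yes refl = P[1+k]
  ... | no z≢1+k = above z w<z (m<1+n⇒m≤n (≤∧≢⇒< z≤1+k z≢1+k))

UpClosed : ℕ → List ℕ → Set
UpClosed Δ M = ∀ x → x ∈ M → x ≢ 1 → parent Δ x ∈ M

UpClosedExcept : ℕ → ℕ → List ℕ → Set
UpClosedExcept Δ v M = ∀ x → x ∈ M → x ≢ 1 → x ≢ v → parent Δ x ∈ M

stalled⇒UpClosed : ∀ Δ {v cs} → ¬ ParentCase Δ v (v ∷ cs) → UpClosedExcept Δ v (v ∷ cs) →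
  UpClosed Δ (v ∷ cs)
stalled⇒UpClosed Δ {v} {cs} stalled closed x x∈ x≢1 with x ≟ v
... | yes refl = decidable-stable (parent Δ x ∈? v ∷ cs) (λ p∉ → stalled (x≢1 , p∉))
... | no x≢v = closed x x∈ x≢1 x≢v

UpClosed⇒UpClosedExcept-∷ : ∀ Δ {u M} → UpClosed Δ M → UpClosedExcept Δ u (u ∷ M)
UpClosed⇒UpClosedExcept-∷ Δ closed x (here refl) _ x≢u = contradiction refl x≢u
UpClosed⇒UpClosedExcept-∷ Δ closed x (there x∈M) x≢1 _ = there (closed x x∈M x≢1)

UpClosedExcept-parent : ∀ Δ {v cs} → UpClosedExcept Δ v (v ∷ cs) →
  UpClosedExcept Δ (parent Δ v) (parent Δ v ∷ v ∷ cs)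
UpClosedExcept-parent Δ closed x (here refl) _ x≢p = contradiction refl x≢p
UpClosedExcept-parent Δ {v} closed x (there x∈) x≢1 _ with x ≟ v
... | yes refl = here refl
... | no x≢v = there (closed x x∈ x≢1 x≢v)

unmarkedLeaf : ∀ Δ {n M} → UpClosed Δ M → length M < n → ∃ λ u → IsLeaf Δ n u × u ∉ M
unmarkedLeaf Δ {n} {M} closed M<n
  with greatestCounterexample (_∈? M) n (λ all → <⇒≱ M<n (marked-all all))
  where
  marked-all : (∀ z → IsVertex n z → z ∈ M) → n ≤ length M
  marked-all all = subst (_≤ length M) (length-applyUpTo suc n)
    (Unique-⊆⇒length≤ (Unique-vertices n)
      (All.tabulate (λ z∈ → all _ (∈vertices⇒IsVertex z∈))))
... | w , w-vertex , w∉M , above = w , (w-vertex , childless) , w∉M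
  where
  childless : ∀ z → ¬ IsChild Δ n w z
  childless z (z≥2 , z≤size , parent≡w) = w∉M (subst (_∈ M) parent≡w parent∈M)
    where
    z∈M : z ∈ M
    z∈M = above z (subst (_< z) parent≡w (parent<self Δ z≥2)) z≤size
    parent∈M : parent Δ z ∈ M
    parent∈M = closed z z∈M (λ z≡1 → <⇒≢ z≥2 (sym z≡1))

TreeOrAdded : ℕ → ℕ → List (ℕ × ℕ) → Rel ℕ 0ℓ
TreeOrAdded Δ n E x y = (2 ≤ x × x ≤ n × y ≡ parent Δ x) ⊎ (x , y) ∈ E

record Invariant (Δ n v : ℕ) (cs : List ℕ) (E : List (ℕ × ℕ)) : Set where
  field
    unique       : Unique (v ∷ cs)
    inRange      : All (IsVertex n) (v ∷ cs)
    upClosed     : UpClosedExcept Δ v (v ∷ cs)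
    startsAtRoot : lastOf v cs ≡ 1
    walk         : Path (SymClosure (TreeOrAdded Δ n E)) (v ∷ cs)

open Invariant

run-invariant : ∀ {Δ n v cs E} → 1 ≤ n → Run Δ n (v ∷ cs) E → Invariant Δ n v cs E
run-invariant n≥1 start = record
  { unique = [] ∷ []
  ; inRange = (≤-refl , n≥1) ∷ []
  ; upClosed = λ { x (here refl) _ x≢1 → contradiction refl x≢1 }
  ; startsAtRoot = refl
  ; walk = tt
  }
run-invariant {Δ} n≥1 (up {v} run _ (v≢1 , p∉)) = record
  { unique = ¬Any⇒All¬ _ p∉ ∷ unique I
  ; inRange = parent-isVertex Δ v≥2 v≤n ∷ inRange I
  ; upClosed = UpClosedExcept-parent Δ (upClosed I)
  ; startsAtRoot = startsAtRoot I
  ; walk = bwd (inj₁ (v≥2 , v≤n , refl)) , walk I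
  }
  where
  I = run-invariant n≥1 run
  v≥1 = proj₁ (All.head (inRange I))
  v≤n = proj₂ (All.head (inRange I))
  v≥2 : 2 ≤ v
  v≥2 = ≤∧≢⇒< v≥1 (≢-sym v≢1)
run-invariant {Δ} n≥1 (down run _ stalled (u≥2 , u≤n , parent≡v) u∉) = record
  { unique = ¬Any⇒All¬ _ u∉ ∷ unique I
  ; inRange = (≤-trans (s≤s z≤n) u≥2 , u≤n) ∷ inRange I
  ; upClosed = UpClosed⇒UpClosedExcept-∷ Δ (stalled⇒UpClosed Δ stalled (upClosed I))
  ; startsAtRoot = startsAtRoot I
  ; walk = fwd (inj₁ (u≥2 , u≤n , sym parent≡v)) , walk I
  }
  where
  I = run-invariant n≥1 run
run-invariant {Δ} n≥1 (jump run _ stalled _ (u-vertex , _) u∉) = record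
  { unique = ¬Any⇒All¬ _ u∉ ∷ unique I
  ; inRange = u-vertex ∷ inRange I
  ; upClosed = UpClosed⇒UpClosedExcept-∷ Δ (stalled⇒UpClosed Δ stalled (upClosed I))
  ; startsAtRoot = startsAtRoot I
  ; walk = bwd (inj₂ (here refl)) , Path-map (SymClosure.map (Sum.map₂ there)) (walk I)
  }
  where
  I = run-invariant n≥1 run

AdjG-symmetric : ∀ {Δ n E cn} → Symmetric (AdjG Δ n E cn)
AdjG-symmetric (x-vertex , y-vertex , x≢y , edge) = y-vertex , x-vertex , ≢-sym x≢y , Sum.swap edge

lastOf-≢-head : ∀ {c d ds} → Unique (c ∷ d ∷ ds) → lastOf d ds ≢ c
lastOf-≢-head {d = d} {ds} u last≡c =
  Unique[x∷xs]⇒x∉xs u (subst (_∈ d ∷ ds) last≡c (lastOf-∈ d ds))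

stalledRun-unmarkedLeaf : ∀ {Δ n v cs E} → 1 ≤ n → Run Δ n (v ∷ cs) E → length (v ∷ cs) < n →
  ¬ ParentCase Δ v (v ∷ cs) → ∃ λ u → IsLeaf Δ n u × u ∉ v ∷ cs
stalledRun-unmarkedLeaf {Δ} n≥1 run marked<n stalled =
  unmarkedLeaf Δ (stalled⇒UpClosed Δ stalled (upClosed (run-invariant n≥1 run))) marked<n

completedRun-isHamCycle : ∀ {Δ n cn cs E} → 3 ≤ n → Run Δ n (cn ∷ cs) E → length (cn ∷ cs) ≡ n →
  IsHamCycle n (AdjG Δ n E cn) (cn ∷ cs)
completedRun-isHamCycle {cs = []} (s≤s ()) _ refl
completedRun-isHamCycle {Δ} {n} {cn} {cs@(_ ∷ _)} {E} n≥3 run length≡n =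
  subst (3 ≤_) (sym length≡n) n≥3 , unique I , cover , path , closingEdge
  where
  n≥1 = ≤-trans (s≤s z≤n) n≥3
  I = run-invariant n≥1 run
  cover : ∀ x → x ∈ cn ∷ cs ⇔ IsVertex n x
  cover x = mk⇔ (lookup (inRange I))
    (Unique-⊆-length≥⇒⊇ (unique I) (All.map IsVertex⇒∈vertices (inRange I))
      (≤-reflexive (trans (length-applyUpTo suc n) (sym length≡n)))
    ∘ IsVertex⇒∈vertices)
  path : Path (AdjG Δ n E cn) (cn ∷ cs)
  path = Path-restrict (inRange I) (unique I) (Path-map linked (walk I))
    where
    linked : SymClosure (TreeOrAdded Δ n E) ⇒
             (λ x y → EdgeGen Δ n E cn x y ⊎ EdgeGen Δ n E cn y x)
    linked (fwd e) = inj₁ (Sum.map₂ inj₁ e)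
    linked (bwd e) = inj₂ (Sum.map₂ inj₁ e)
  closingEdge : AdjG Δ n E cn (lastOf cn cs) cn
  closingEdge = subst (λ r → AdjG Δ n E cn r cn) (sym (startsAtRoot I))
    ((≤-refl , n≥1) , All.head (inRange I) ,
     subst (_≢ cn) (startsAtRoot I) (lastOf-≢-head (unique I)) ,
     inj₂ (inj₂ (inj₂ (refl , refl))))

mainTheorem1 : (Δ n : ℕ) → 3 ≤ Δ → 3 ≤ n →
    ((v : ℕ) (cs : List ℕ) (E : List (ℕ × ℕ)) → Run Δ n (v ∷ cs) E →
    length (v ∷ cs) < n → ¬ ParentCase Δ v (v ∷ cs) →
    (∀ w → IsChild Δ n v w → w ∈ (v ∷ cs)) →
    ∃ λ u → IsLeaf Δ n u × u ∉ (v ∷ cs))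
    ×
    ((cn : ℕ) (cs : List ℕ) (E : List (ℕ × ℕ)) → Run Δ n (cn ∷ cs) E →
    length (cn ∷ cs) ≡ n →
    Unique (cn ∷ cs)
    × IsHamCycle n (AdjG Δ n E cn) (reverse (cn ∷ cs))
    × IsHamiltonian n (AdjG Δ n E cn))
mainTheorem1 Δ n _ n≥3 =
  (λ v cs E run marked<n stalled _ → stalledRun-unmarkedLeaf n≥1 run marked<n stalled) ,
  (λ cn cs E run length≡n →
    let cycle = IsHamCycle-reverse (AdjG-symmetric {Δ}) (completedRun-isHamCycle n≥3 run length≡n)
    in unique (run-invariant n≥1 run) , cycle , reverse (cn ∷ cs) , cycle)
  where
  n≥1 : 1 ≤ n
  n≥1 = ≤-trans (s≤s z≤n) n≥3
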